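{- Let $C$ be a reachable command, $\Gamma$ a resource context, $h,h_R$ heaps with $h\bot h_R$ and $s$ a store, $\rho$ a resource configuration, $Q,R$ assertions and $A\subseteq\mathbf{Var}$, such that $s,h_R\models R$. If $\mathit{Safe}_n(C,s,h,\rho,\Gamma,Q,A)$ holds and $mod(C)\cap FV(R)=\emptyset$, then $\mathit{Safe}_n(C,s,h\uplus h_R,\rho,\Gamma,Q\ast R,A\cup FV(R))$ holds.
   Context: Stores $s:\mathbf{Var}\to\mathbf{Val}$; finite partial heaps $h$; separation-logic assertions with standard satisfaction and free variables $FV$; $h\bot g$ disjoint domains, $h\uplus g$ union. Resource context $\Gamma=r_1(X_1):R_1,\dots,r_n(X_n):R_n$ (distinct names, $X_i\subseteq\mathbf{Var}$, precise $R_i$, $FV(R_i)\subseteq X_i$); $PV(r_i)=X_i$, $\Gamma(r_i)=R_i$, $\circledast_{r\in D}\Gamma(r)$ separating conjunction over $D$. Resource configuration: triple $(O,L,D)$ of pairwise disjoint sets of resource names; $r\in\rho$ iff $r\in O\cup L\cup D$; $\rho\setminus\{r\}$ componentwise removal. Commands: $\mathsf{skip}$, basic commands $x:=e$, $x:=[e]$, $[e]:=e'$, $x:=\mathsf{cons}(\dots)$, $\mathsf{dispose}(e)$ (standard semantics $[c](s,h)$, pair or $\mathsf{abort}$), $C_1;C_2$, $\mathsf{if}$, $\mathsf{while}$, $\mathsf{resource}\ r\ \mathsf{in}\ C$, $\mathsf{with}\ r\ \mathsf{when}\ B\ \mathsf{do}\ C$, $C_1\|C_2$ (these are unextended), and $\mathsf{within}\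 r\ \mathsf{do}\ C$. $mod(C)$: variables $x$ such that $C$ contains $x:=e$, $x:=[e]$ or $x:=\mathsf{cons}(\dots)$. $Locked(C_1;C_2)=Locked(C_1)$, $Locked(C_1\|C_2)=Locked(C_1)\cup Locked(C_2)$, $Locked(\mathsf{resource}\ r\ \mathsf{in}\ C)=Locked(C)\setminus\{r\}$, $Locked(\mathsf{within}\ r\ \mathsf{do}\ C)=Locked(C)\cup\{r\}$, else $\emptyset$. Program transitions $\to_p$: (S1) $\mathsf{skip};C_2\to C_2$; (S2) $C_1;C_2$ steps via $C_1$; (LP) while unfolds to $\mathsf{if}\ B\ \mathsf{then}\ (C;\mathsf{while}\ B\ \mathsf{do}\ C)\ \mathsf{else}\ \mathsf{skip}$; (IF1/IF2) by $s(B)$; (P1/P2) a parallel component steps; (P3) $\mathsf{skip}\|\mathsf{skip}\to\mathsf{skip}$; (R0) $\mathsf{resource}\ r\ \mathsf{in}\ \mathsf{skip}\to\mathsf{skip}$ if $r\notin\rho$; (R1) if $r\notin\rho=(O,L,D)$, $r\in Locked(C)$, $C,(s,h,(O\cup\{r\},L,D))\to_pC',(s',h',\rho')$ then $\mathsf{resource}\ r\ \mathsf{in}\ C,(s,h,\rho)\to_p\mathsf{resource}\ r\ \mathsf{in}\ C',(s',h',\rho'\setminus\{r\})$; (R2) same with $r\notin Locked(C)$ and $(O,L,D\cup\{r\})$; (W0) $\mathsf{with}\ r\ \mathsf{when}\ B\ \mathsf{do}\ C,(s,h,(O,L,D\cup\{r\}))\to_p\mathsf{within}\ r\ \mathsf{do}\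 C,(s,h,(O\cup\{r\},L,D))$ if $s(B)=\texttt{true}$; (W1) if $r\in O$ and $C,(s,h,(O\setminus\{r\},L,D))\to_pC',(s',h',(O',L',D'))$ then $\mathsf{within}\ r\ \mathsf{do}\ C,(s,h,(O,L,D))\to_p\mathsf{within}\ r\ \mathsf{do}\ C',(s',h',(O'\cup\{r\},L',D'))$; (W2) $\mathsf{within}\ r\ \mathsf{do}\ \mathsf{skip},(s,h,(O\cup\{r\},L,D))\to_p\mathsf{skip},(s,h,(O,L,D\cup\{r\}))$; (BCT) $c,(s,h,\rho)\to_p\mathsf{skip},(s',h',\rho)$ if $[c](s,h)=(s',h')$. Abort: (RA) $\mathsf{resource}\ r$ with $r\in\rho$; (WA) $\mathsf{with}\ r$ with $r\notin\rho$; (RA1)/(RA2) body aborts under the configurations of (R1)/(R2); (BCA) $[c](s,h)=\mathsf{abort}$; (SA) first component of $;$ aborts; (WA1) body of $\mathsf{within}\ r$ aborts under $\rho\setminus\{r\}$; (WA2) $\mathsf{within}\ r$ with $r\notin O$; (PA1/PA2) a component of $\|$ aborts. A command $C'$ is reachable if for some unextended command $C_0$ there are states $\sigma,\sigma'$ and $k$ with $C_0,\sigma\to_p^kC',\sigma'$ and $C_0,\sigma\not\to_p^j\mathsf{abort}$ for all $j\le k$. Environment: $(s,h,(O,L,D))\stackrel{A}{\leftrightsquigarrow}(s',h,(O,L',D'))$ iff $s(x)=s'(x)$ for $x\in A$ and $L'\cup D'=L\cup D$; with $A'=A\cup\bigcup_{r\in Locked(C)}PV(r)$, if $(s,h,\rho)\stackrel{A'}{\leftrightsquigarrow}(s',h,\rho')$,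 $\rho=(O,L,D)$, $\rho'=(O,L',D')$, $s,h_G\models\circledast_{r\in D}\Gamma(r)$, $s',h'_G\models\circledast_{r\in D'}\Gamma(r)$, then $C,(s,h\uplus h_G,\rho)\xrightarrow{A,\Gamma}_eC,(s',h\uplus h'_G,\rho')$; $\xrightarrow{A,\Gamma}=\to_p\cup\xrightarrow{A,\Gamma}_e$. $chng(C)$: variables $x$ such that the next transition of $C$ can execute $x:=e$, $x:=[e]$ or $x:=\mathsf{cons}(\dots)$. Safety: $\mathit{Safe}_0$ always holds; $\mathit{Safe}_{n+1}(C,s,h,\rho,\Gamma,Q,A)$, $\rho=(O,L,D)$, iff (i) $C=\mathsf{skip}\Rightarrow s,h\models Q$; (ii) $C,(s,h,\rho)\not\to_p\mathsf{abort}$; (iii) $chng(C)\cap\bigcup_{r\in L\cup D}PV(r)=\emptyset$; (iv) for every $h_G\bot h$ with $s,h_G\models\circledast_{r\in D}\Gamma(r)$ and every $C,(s,h\uplus h_G,\rho)\xrightarrow{A,\Gamma}C',(s',\hat h,\rho')$, $\rho'=(O',L',D')$, there exist $h',h'_G$ with $\hat h=h'\uplus h'_G$, $s',h'_G\models\circledast_{r\in D'}\Gamma(r)$ and $\mathit{Safe}_n(C',s',h',\rho',\Gamma,Q,A)$. -}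

module Defs where

open import Data.Nat as ℕ using (ℕ; zero; suc; _≤_)
open import Data.Integer as ℤ using (ℤ; +_)
open import Data.Bool using (Bool; true; false; _∨_; _∧_; not; T; if_then_else_)
open import Data.Maybe using (Maybe; just; nothing)
open import Data.List using (List; []; _∷_; map)
open import Data.List.Membership.Propositional using (_∈_)
open import Data.List.Relation.Unary.All using (All)
open import Data.List.Relation.Unary.Unique.Propositional using (Unique)
open import Data.Product using (Σ; _×_; _,_)
open import Data.Sum using (_⊎_)
open import Data.Empty using (⊥)
open import Data.Unit using (⊤)
open import Relation.Nullary using (¬_; does)
open import Relation.Binary.PropositionalEquality using (_≡_; _≢_)

Var : Set
Var = ℕ

Val : Set
Val = ℤ

-- locations are values (addresses are integers)
Loc : Set
Loc = ℤ

RName : Set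
RName = ℕ

-- arbitrary (possibly infinite) sets of variables
VarSet : Set₁
VarSet = Var → Set

_∪ᵥ_ : VarSet → VarSet → VarSet
(A ∪ᵥ B) x = A x ⊎ B x

Store : Set
Store = Var → Val

_[_↦_] : Store → Var → Val → Store
(s [ x ↦ v ]) y = if does (y ℕ.≟ x) then v else s y

record Heap : Set where
  field
    fun    : Loc → Maybe Val
    finite : Σ (List Loc) λ dom → ∀ l → fun l ≢ nothing → l ∈ dom
open Heap public

Disjoint : Heap → Heap → Set
Disjoint h g = ∀ l → fun h l ≡ nothing ⊎ fun g l ≡ nothing

merge : Maybe Val → Maybe Val → Maybe Val
merge (just v) _ = just v
merge nothing m = m

HUnion : Heap → Heap → Heap → Set
HUnion h g k = Disjoint h g × (∀ l → fun k l ≡ merge (fun h l) (fun g l))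

EmptyH : Heap → Set
EmptyH h = ∀ l → fun h l ≡ nothing

SubHeap : Heap → Heap → Set
SubHeap h k = ∀ l v → fun h l ≡ just v → fun k l ≡ just v

HEq : Heap → Heap → Set
HEq h k = ∀ l → fun h l ≡ fun k l

infixl 6 _⊕_ _⊖_
infixl 7 _⊗_
data Exp : Set where
  num         : ℤ → Exp
  var         : Var → Exp
  _⊕_ _⊖_ _⊗_ : Exp → Exp → Exp

⟦_⟧ : Exp → Store → Val
⟦ num n ⟧ s = n
⟦ var x ⟧ s = s x
⟦ e ⊕ e' ⟧ s = ⟦ e ⟧ s ℤ.+ ⟦ e' ⟧ s
⟦ e ⊖ e' ⟧ s = ⟦ e ⟧ s ℤ.- ⟦ e' ⟧ s
⟦ e ⊗ e' ⟧ s = ⟦ e ⟧ s ℤ.* ⟦ e' ⟧ s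

FVₑ : Exp → VarSet
FVₑ (num _) y = ⊥
FVₑ (var x) y = y ≡ x
FVₑ (e ⊕ e') y = FVₑ e y ⊎ FVₑ e' y
FVₑ (e ⊖ e') y = FVₑ e y ⊎ FVₑ e' y
FVₑ (e ⊗ e') y = FVₑ e y ⊎ FVₑ e' y

data BExp : Set where
  btrue bfalse : BExp
  _≐_ _≤ₑ_     : Exp → Exp → BExp
  bnot         : BExp → BExp
  _band_ _bor_ : BExp → BExp → BExp

⟦_⟧ᵇ : BExp → Store → Bool
⟦ btrue ⟧ᵇ s = true
⟦ bfalse ⟧ᵇ s = false
⟦ e ≐ e' ⟧ᵇ s = does (⟦ e ⟧ s ℤ.≟ ⟦ e' ⟧ s)
⟦ e ≤ₑ e' ⟧ᵇ s = does (⟦ e ⟧ s ℤ.≤? ⟦ e' ⟧ s)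
⟦ bnot b ⟧ᵇ s = not (⟦ b ⟧ᵇ s)
⟦ b band b' ⟧ᵇ s = ⟦ b ⟧ᵇ s ∧ ⟦ b' ⟧ᵇ s
⟦ b bor b' ⟧ᵇ s = ⟦ b ⟧ᵇ s ∨ ⟦ b' ⟧ᵇ s

FVᵇ : BExp → VarSet
FVᵇ btrue y = ⊥
FVᵇ bfalse y = ⊥
FVᵇ (e ≐ e') y = FVₑ e y ⊎ FVₑ e' y
FVᵇ (e ≤ₑ e') y = FVₑ e y ⊎ FVₑ e' y
FVᵇ (bnot b) y = FVᵇ b y
FVᵇ (b band b') y = FVᵇ b y ⊎ FVᵇ b' y
FVᵇ (b bor b') y = FVᵇ b y ⊎ FVᵇ b' y

infixr 6 _∗_
infixr 5 _-∗_
data Assn : Set where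
  pure      : BExp → Assn
  emp       : Assn
  _↦_       : Exp → Exp → Assn
  _∗_ _-∗_  : Assn → Assn → Assn
  _∧ₐ_ _∨ₐ_ : Assn → Assn → Assn
  ¬ₐ        : Assn → Assn
  ∀ₐ ∃ₐ     : Var → Assn → Assn

sat : Store → Heap → Assn → Set
sat s h (pure b) = T (⟦ b ⟧ᵇ s)
sat s h emp = EmptyH h
sat s h (e ↦ e') =
  ∀ l → fun h l ≡ (if does (l ℤ.≟ ⟦ e ⟧ s) then just (⟦ e' ⟧ s) else nothing)
sat s h (P ∗ Q) = Σ Heap λ h₁ → Σ Heap λ h₂ → HUnion h₁ h₂ h × sat s h₁ P × sat s h₂ Q
sat s h (P -∗ Q) = ∀ h₁ h₂ → HUnion h h₁ h₂ → sat s h₁ P → sat s h₂ Q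
sat s h (P ∧ₐ Q) = sat s h P × sat s h Q
sat s h (P ∨ₐ Q) = sat s h P ⊎ sat s h Q
sat s h (¬ₐ P) = ¬ sat s h P
sat s h (∀ₐ x P) = ∀ v → sat (s [ x ↦ v ]) h P
sat s h (∃ₐ x P) = Σ Val λ v → sat (s [ x ↦ v ]) h P

FV : Assn → VarSet
FV (pure b) y = FVᵇ b y
FV emp y = ⊥
FV (e ↦ e') y = FVₑ e y ⊎ FVₑ e' y
FV (P ∗ Q) y = FV P y ⊎ FV Q y
FV (P -∗ Q) y = FV P y ⊎ FV Q y
FV (P ∧ₐ Q) y = FV P y ⊎ FV Q y
FV (P ∨ₐ Q) y = FV P y ⊎ FV Q y
FV (¬ₐ P) y = FV P y
FV (∀ₐ x P) y = y ≢ x × FV P y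
FV (∃ₐ x P) y = y ≢ x × FV P y

Precise : Assn → Set
Precise R = ∀ s h h₁ h₂ → SubHeap h₁ h → SubHeap h₂ h →
            sat s h₁ R → sat s h₂ R → HEq h₁ h₂

record Res : Set₁ where
  constructor res
  field
    name : RName
    vars : VarSet
    inv  : Assn
open Res public

Ctx : Set₁
Ctx = List Res

ResCtx : Ctx → Set₁
ResCtx Γ = Unique (map name Γ) ×
           All (λ e → Precise (inv e) × (∀ x → FV (inv e) x → vars e x)) Γ

-- x ∈ PV(r)   (empty if r is not declared in Γ)
PV : Ctx → RName → VarSet
PV [] r x = ⊥
PV (e ∷ Γ) r x = (name e ≡ r × vars e x) ⊎ PV Γ r x

-- s , h ⊨ ⊛_{r ∈ D} Γ(r)   (undeclared names contribute emp)
RSet : Set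
RSet = RName → Bool

Star : Ctx → RSet → Store → Heap → Set
Star [] D s h = EmptyH h
Star (e ∷ Γ) D s h =
  if D (name e)
  then (Σ Heap λ h₁ → Σ Heap λ h₂ → HUnion h₁ h₂ h × sat s h₁ (inv e) × Star Γ D s h₂)
  else Star Γ D s h

record Config : Set where
  constructor config
  field
    O L D : RSet
open Config public

addR : RSet → RName → RSet
addR X r x = X x ∨ does (x ℕ.≟ r)

delR : RSet → RName → RSet
delR X r x = X x ∧ not (does (x ℕ.≟ r))

IsConfig : Config → Set
IsConfig ρ = ∀ r → (T (O ρ r ∧ L ρ r) → ⊥) × (T (O ρ r ∧ D ρ r) → ⊥) × (T (L ρ r ∧ D ρ r) → ⊥)

_∈ρ_ : RName → Config → Set
r ∈ρ ρ = T (O ρ r ∨ L ρ r ∨ D ρ r)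

_∖ρ_ : Config → RName → Config
ρ ∖ρ r = config (delR (O ρ) r) (delR (L ρ) r) (delR (D ρ) r)

data Basic : Set where
  assign  : Var → Exp → Basic
  load    : Var → Exp → Basic
  store   : Exp → Exp → Basic
  cons    : Var → List Exp → Basic
  dispose : Exp → Basic

infixr 4 _⨾_
infixr 3 _∥_
data Cmd : Set where
  skip     : Cmd
  basic    : Basic → Cmd
  _⨾_     : Cmd → Cmd → Cmd
  ifte     : BExp → Cmd → Cmd → Cmd
  while    : BExp → Cmd → Cmd
  resource : RName → Cmd → Cmd
  withr    : RName → BExp → Cmd → Cmd
  _∥_      : Cmd → Cmd → Cmd
  within   : RName → Cmd → Cmd

Unextended : Cmd → Set
Unextended skip = ⊤
Unextended (basic c) = ⊤
Unextended (C₁ ⨾ C₂) = Unextended C₁ × Unextended C₂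
Unextended (ifte B C₁ C₂) = Unextended C₁ × Unextended C₂
Unextended (while B C) = Unextended C
Unextended (resource r C) = Unextended C
Unextended (withr r B C) = Unextended C
Unextended (C₁ ∥ C₂) = Unextended C₁ × Unextended C₂
Unextended (within r C) = ⊥

ModB : Basic → VarSet
ModB (assign x e) y = y ≡ x
ModB (load x e) y = y ≡ x
ModB (store e e') y = ⊥
ModB (cons x es) y = y ≡ x
ModB (dispose e) y = ⊥

Mod : Cmd → VarSet
Mod skip y = ⊥
Mod (basic c) y = ModB c y
Mod (C₁ ⨾ C₂) y = Mod C₁ y ⊎ Mod C₂ y
Mod (ifte B C₁ C₂) y = Mod C₁ y ⊎ Mod C₂ y
Mod (while B C) y = Mod C y
Mod (resource r C) y = Mod C y
Mod (withr r B C) y = Mod C y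
Mod (C₁ ∥ C₂) y = Mod C₁ y ⊎ Mod C₂ y
Mod (within r C) y = Mod C y

-- chng(C): variables the next transition of C can assign
Chng : Cmd → VarSet
Chng (basic c) y = ModB c y
Chng (C₁ ⨾ C₂) y = Chng C₁ y
Chng (C₁ ∥ C₂) y = Chng C₁ y ⊎ Chng C₂ y
Chng (resource r C) y = Chng C y
Chng (within r C) y = Chng C y
Chng _ y = ⊥

Locked : Cmd → RName → Set
Locked (C₁ ⨾ C₂) r = Locked C₁ r
Locked (C₁ ∥ C₂) r = Locked C₁ r ⊎ Locked C₂ r
Locked (resource r' C) r = Locked C r × r ≢ r'
Locked (within r' C) r = Locked C r ⊎ r ≡ r'
Locked _ r = ⊥

allocAt : Loc → List Val → Loc → Maybe Val
allocAt l [] l' = nothing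
allocAt l (v ∷ vs) l' = if does (l' ℤ.≟ l) then just v else allocAt (l ℤ.+ + 1) vs l'

data BStep : Basic → Store → Heap → Store → Heap → Set where
  assign-step  : ∀ {x e s h} → BStep (assign x e) s h (s [ x ↦ ⟦ e ⟧ s ]) h
  load-step    : ∀ {x e s h v} → fun h (⟦ e ⟧ s) ≡ just v →
                 BStep (load x e) s h (s [ x ↦ v ]) h
  store-step   : ∀ {e e' s h h' v} → fun h (⟦ e ⟧ s) ≡ just v →
                 (∀ l → fun h' l ≡ (if does (l ℤ.≟ ⟦ e ⟧ s) then just (⟦ e' ⟧ s) else fun h l)) →
                 BStep (store e e') s h s h'
  cons-step    : ∀ {x es s h h'} (l : Loc) →
                 (∀ l' → allocAt l (map (λ e → ⟦ e ⟧ s) es) l' ≢ nothing → fun h l' ≡ nothing) →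
                 (∀ l' → fun h' l' ≡ merge (allocAt l (map (λ e → ⟦ e ⟧ s) es) l') (fun h l')) →
                 BStep (cons x es) s h (s [ x ↦ l ]) h'
  dispose-step : ∀ {e s h h' v} → fun h (⟦ e ⟧ s) ≡ just v →
                 (∀ l → fun h' l ≡ (if does (l ℤ.≟ ⟦ e ⟧ s) then nothing else fun h l)) →
                 BStep (dispose e) s h s h'

data BAbort : Basic → Store → Heap → Set where
  load-abort    : ∀ {x e s h} → fun h (⟦ e ⟧ s) ≡ nothing → BAbort (load x e) s h
  store-abort   : ∀ {e e' s h} → fun h (⟦ e ⟧ s) ≡ nothing → BAbort (store e e') s h
  dispose-abort : ∀ {e s h} → fun h (⟦ e ⟧ s) ≡ nothing → BAbort (dispose e) s h

data Step : Cmd → Store → Heap → Config → Cmd → Store → Heap → Config → Set where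
  S1  : ∀ {C₂ s h ρ} → Step (skip ⨾ C₂) s h ρ C₂ s h ρ
  S2  : ∀ {C₁ C₁' C₂ s h ρ s' h' ρ'} → Step C₁ s h ρ C₁' s' h' ρ' →
        Step (C₁ ⨾ C₂) s h ρ (C₁' ⨾ C₂) s' h' ρ'
  LP  : ∀ {B C s h ρ} → Step (while B C) s h ρ (ifte B (C ⨾ while B C) skip) s h ρ
  IF1 : ∀ {B C₁ C₂ s h ρ} → ⟦ B ⟧ᵇ s ≡ true → Step (ifte B C₁ C₂) s h ρ C₁ s h ρ
  IF2 : ∀ {B C₁ C₂ s h ρ} → ⟦ B ⟧ᵇ s ≡ false → Step (ifte B C₁ C₂) s h ρ C₂ s h ρ
  P1  : ∀ {C₁ C₁' C₂ s h ρ s' h' ρ'} → Step C₁ s h ρ C₁' s' h' ρ' →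
        Step (C₁ ∥ C₂) s h ρ (C₁' ∥ C₂) s' h' ρ'
  P2  : ∀ {C₁ C₂ C₂' s h ρ s' h' ρ'} → Step C₂ s h ρ C₂' s' h' ρ' →
        Step (C₁ ∥ C₂) s h ρ (C₁ ∥ C₂') s' h' ρ'
  P3  : ∀ {s h ρ} → Step (skip ∥ skip) s h ρ skip s h ρ
  R0  : ∀ {r s h ρ} → ¬ (r ∈ρ ρ) → Step (resource r skip) s h ρ skip s h ρ
  R1  : ∀ {r C C' s h ρ s' h' ρ'} → ¬ (r ∈ρ ρ) → Locked C r →
        Step C s h (config (addR (O ρ) r) (L ρ) (D ρ)) C' s' h' ρ' →
        Step (resource r C) s h ρ (resource r C') s' h' (ρ' ∖ρ r)
  R2  : ∀ {r C C' s h ρ s' h' ρ'} → ¬ (r ∈ρ ρ) → ¬ Locked C r →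
        Step C s h (config (O ρ) (L ρ) (addR (D ρ) r)) C' s' h' ρ' →
        Step (resource r C) s h ρ (resource r C') s' h' (ρ' ∖ρ r)
  W0  : ∀ {r B C s h ρ} → T (D ρ r) → ⟦ B ⟧ᵇ s ≡ true →
        Step (withr r B C) s h ρ (within r C) s h (config (addR (O ρ) r) (L ρ) (delR (D ρ) r))
  W1  : ∀ {r C C' s h ρ s' h' ρ'} → T (O ρ r) →
        Step C s h (config (delR (O ρ) r) (L ρ) (D ρ)) C' s' h' ρ' →
        Step (within r C) s h ρ (within r C') s' h' (config (addR (O ρ') r) (L ρ') (D ρ'))
  W2  : ∀ {r s h ρ} → T (O ρ r) →
        Step (within r skip) s h ρ skip s h (config (delR (O ρ) r) (L ρ) (addR (D ρ) r))
  BCT : ∀ {c s h ρ s' h'} → BStep c s h s' h' → Step (basic c) s h ρ skip s' h' ρ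

data Abort : Cmd → Store → Heap → Config → Set where
  RA  : ∀ {r C s h ρ} → r ∈ρ ρ → Abort (resource r C) s h ρ
  WA  : ∀ {r B C s h ρ} → ¬ (r ∈ρ ρ) → Abort (withr r B C) s h ρ
  RA1 : ∀ {r C s h ρ} → ¬ (r ∈ρ ρ) → Locked C r →
        Abort C s h (config (addR (O ρ) r) (L ρ) (D ρ)) → Abort (resource r C) s h ρ
  RA2 : ∀ {r C s h ρ} → ¬ (r ∈ρ ρ) → ¬ Locked C r →
        Abort C s h (config (O ρ) (L ρ) (addR (D ρ) r)) → Abort (resource r C) s h ρ
  BCA : ∀ {c s h ρ} → BAbort c s h → Abort (basic c) s h ρ
  SA  : ∀ {C₁ C₂ s h ρ} → Abort C₁ s h ρ → Abort (C₁ ⨾ C₂) s h ρ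
  WA1 : ∀ {r C s h ρ} → Abort C s h (ρ ∖ρ r) → Abort (within r C) s h ρ
  WA2 : ∀ {r C s h ρ} → ¬ T (O ρ r) → Abort (within r C) s h ρ
  PA1 : ∀ {C₁ C₂ s h ρ} → Abort C₁ s h ρ → Abort (C₁ ∥ C₂) s h ρ
  PA2 : ∀ {C₁ C₂ s h ρ} → Abort C₂ s h ρ → Abort (C₁ ∥ C₂) s h ρ

data Steps : ℕ → Cmd → Store → Heap → Config → Cmd → Store → Heap → Config → Set where
  done : ∀ {C s h ρ} → Steps zero C s h ρ C s h ρ
  more : ∀ {k C s h ρ C' s' h' ρ' C'' s'' h'' ρ''} →
         Step C s h ρ C' s' h' ρ' → Steps k C' s' h' ρ' C'' s'' h'' ρ'' →
         Steps (suc k) C s h ρ C'' s'' h'' ρ''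

AbortsIn : ℕ → Cmd → Store → Heap → Config → Set
AbortsIn zero C s h ρ = ⊥
AbortsIn (suc j) C s h ρ =
  Σ Cmd λ C' → Σ Store λ s' → Σ Heap λ h' → Σ Config λ ρ' →
    Steps j C s h ρ C' s' h' ρ' × Abort C' s' h' ρ'

Reachable : Cmd → Set
Reachable C' =
  Σ Cmd λ C₀ → Unextended C₀ ×
  Σ Store λ s → Σ Heap λ h → Σ Config λ ρ → IsConfig ρ ×
  Σ Store λ s' → Σ Heap λ h' → Σ Config λ ρ' → Σ ℕ λ k →
    Steps k C₀ s h ρ C' s' h' ρ' × (∀ j → j ≤ k → ¬ AbortsIn j C₀ s h ρ)

data EnvStep (A : VarSet) (Γ : Ctx) (C : Cmd) :
             Store → Heap → Config → Store → Heap → Config → Set where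
  env : ∀ {s ρ s' L' D'} (h hG hG' hh hh' : Heap) →
        HUnion h hG hh → HUnion h hG' hh' →
        (∀ x → (A x ⊎ Σ RName (λ r → Locked C r × PV Γ r x)) → s x ≡ s' x) →
        (∀ r → (L' r ∨ D' r) ≡ (L ρ r ∨ D ρ r)) →
        IsConfig (config (O ρ) L' D') →
        Star Γ (D ρ) s hG → Star Γ D' s' hG' →
        EnvStep A Γ C s hh ρ s' hh' (config (O ρ) L' D')

data Trans (A : VarSet) (Γ : Ctx) :
           Cmd → Store → Heap → Config → Cmd → Store → Heap → Config → Set where
  prog : ∀ {C s h ρ C' s' h' ρ'} → Step C s h ρ C' s' h' ρ' → Trans A Γ C s h ρ C' s' h' ρ'
  envt : ∀ {C s h ρ s' h' ρ'} → EnvStep A Γ C s h ρ s' h' ρ' → Trans A Γ C s h ρ C s' h' ρ'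

Safe : ℕ → Cmd → Store → Heap → Config → Ctx → Assn → VarSet → Set
Safe zero C s h ρ Γ Q A = ⊤
Safe (suc n) C s h ρ Γ Q A =
  (C ≡ skip → sat s h Q) ×
  (¬ Abort C s h ρ) ×
  (∀ x → Chng C x → ∀ r → T (L ρ r ∨ D ρ r) → ¬ PV Γ r x) ×
  (∀ hG hh → HUnion h hG hh → Star Γ (D ρ) s hG →
   ∀ C' s' hh' ρ' → Trans A Γ C s hh ρ C' s' hh' ρ' →
   Σ Heap λ h' → Σ Heap λ hG' →
     HUnion h' hG' hh' × Star Γ (D ρ') s' hG' × Safe n C' s' h' ρ' Γ Q A)

module Submission where

-- A program step of C from h ⊎ hR ⊎ hG is already a step from h ⊎ hG: C cannot fault there, since it
-- is safe on h, and a non-faulting basic command changes only cells it owns, so the frame hR is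
-- carried along untouched.  R keeps holding because the step only assigns variables in mod(C).
-- An environment step must preserve A ∪ FV(R), so again R holds afterwards; precision of the
-- invariants identifies the environment's part of the heap, so the step can be replayed without hR.

open import Defs
open import Data.Nat using (ℕ; zero; suc)
import Data.Nat as ℕ
import Data.Integer as ℤ
open import Data.Bool using (true; false; T; not; _∧_; _∨_; if_then_else_)
open import Data.Maybe using (Maybe; just; nothing)
open import Data.List using ([]; _∷_; _++_; map)
open import Data.List.Membership.Propositional.Properties using (∈-++⁺ˡ; ∈-++⁺ʳ)
open import Data.List.Relation.Unary.All as All using (All; _∷_)
open import Data.Product as Σ using (Σ; _×_; _,_; proj₁; proj₂)
open import Data.Sum as ⊎ using (_⊎_; inj₁; inj₂)
open import Data.Unit using (tt)
open import Function using (_∘_)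
open import Relation.Nullary using (¬_; Dec; yes; no; does; contradiction)
open import Relation.Nullary.Decidable using (T?; ¬?; _×-dec_; _⊎-dec_; dec-true; dec-false)
open import Relation.Binary.PropositionalEquality hiding ([_])

infix 4 _#_
_#_ : Maybe Val → Maybe Val → Set
m # n = m ≡ nothing ⊎ n ≡ nothing

merge-identityʳ : ∀ m → merge m nothing ≡ m
merge-identityʳ (just _) = refl
merge-identityʳ nothing  = refl

merge-comm : ∀ {m n} → m # n → merge m n ≡ merge n m
merge-comm {n = n} (inj₁ refl) = sym (merge-identityʳ n)
merge-comm {m = m} (inj₂ refl) = merge-identityʳ m

merge≢nothing : ∀ m {n} → merge m n ≢ nothing → m ≢ nothing ⊎ n ≢ nothing
merge≢nothing (just _) _ = inj₁ λ ()
merge≢nothing nothing  n≢nothing = inj₂ n≢nothing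

merge-regroup : ∀ a {b d} → a # b → merge a b # d →
                a # d × merge a d # b × merge (merge a b) d ≡ merge (merge a d) b
merge-regroup (just _) (inj₂ refl) (inj₂ refl) = inj₂ refl , inj₂ refl , refl
merge-regroup (just _) (inj₁ ()) _
merge-regroup (just _) (inj₂ refl) (inj₁ ())
merge-regroup nothing _ b#d = inj₁ refl , ⊎.swap b#d , merge-comm b#d

merge-cancelʳ : ∀ {a a'} g → a # g → a' # g → merge a g ≡ merge a' g → a ≡ a'
merge-cancelʳ {a} {a'} nothing _ _ eq =
  trans (sym (merge-identityʳ a)) (trans eq (merge-identityʳ a'))
merge-cancelʳ (just _) (inj₁ refl) (inj₁ refl) _ = refl
merge-cancelʳ (just _) (inj₂ ()) _ _
merge-cancelʳ (just _) _ (inj₂ ()) _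

infixl 6 _∖ₘ_
_∖ₘ_ : Maybe Val → Maybe Val → Maybe Val
m ∖ₘ just _  = nothing
m ∖ₘ nothing = m

∖ₘ-nothing : ∀ {m} n → m ≡ nothing → m ∖ₘ n ≡ nothing
∖ₘ-nothing (just _) _ = refl
∖ₘ-nothing nothing  m≡nothing = m≡nothing

merge-update : ∀ (f : Maybe Val → Maybe Val) hs hR {hb hb'} →
               hs # hR → hb ≡ merge hs hR → (∀ m → f m ≡ m) ⊎ hR ≡ nothing → hb' ≡ f hb →
               hb' ∖ₘ hR # hR × hb' ≡ merge (hb' ∖ₘ hR) hR × hb' ∖ₘ hR ≡ f hs
merge-update f hs nothing _ refl _ refl =
  inj₂ refl , sym (merge-identityʳ _) , cong f (merge-identityʳ hs)
merge-update f .nothing (just w) (inj₁ refl) refl (inj₁ f≗id) refl =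
  inj₁ refl , f≗id (just w) , sym (f≗id nothing)
merge-update f _ (just _) (inj₂ ()) _ _ _
merge-update f _ (just _) _ _ (inj₂ ()) _

infixl 6 _∪ₕ_ _∖ₕ_
_∪ₕ_ : Heap → Heap → Heap
fun (h ∪ₕ g) l = merge (fun h l) (fun g l)
finite (h ∪ₕ g) = proj₁ (finite h) ++ proj₁ (finite g) , λ l ≢nothing →
  ⊎.[ ∈-++⁺ˡ ∘ proj₂ (finite h) l , ∈-++⁺ʳ (proj₁ (finite h)) ∘ proj₂ (finite g) l ]
    (merge≢nothing (fun h l) ≢nothing)

_∖ₕ_ : Heap → Heap → Heap
fun (h ∖ₕ g) l = fun h l ∖ₘ fun g l
finite (h ∖ₕ g) = proj₁ (finite h) , λ l ≢nothing →
  proj₂ (finite h) l (≢nothing ∘ ∖ₘ-nothing (fun g l))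

HUnion-regroup : ∀ {a b c d e} → HUnion a b c → HUnion c d e →
                 HUnion a d (a ∪ₕ d) × HUnion (a ∪ₕ d) b e
HUnion-regroup {a} {b} {c} {d} {e} (a#b , c≡ab) (c#d , e≡cd) =
  ((proj₁ ∘ cell) , λ _ → refl) , (proj₁ ∘ proj₂ ∘ cell) , λ l → trans (e≡cd l) (e≡ l)
  where
  cell : ∀ l → fun a l # fun d l × merge (fun a l) (fun d l) # fun b l ×
               merge (merge (fun a l) (fun b l)) (fun d l) ≡ merge (merge (fun a l) (fun d l)) (fun b l)
  cell l = merge-regroup (fun a l) (a#b l) (subst (_# fun d l) (c≡ab l) (c#d l))
  e≡ : ∀ l → merge (fun c l) (fun d l) ≡ merge (merge (fun a l) (fun d l)) (fun b l)
  e≡ l = trans (cong (λ m → merge m (fun d l)) (c≡ab l)) (proj₂ (proj₂ (cell l)))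

HUnion-cancelʳ : ∀ {a g a' g' h} → HUnion a g h → HUnion a' g' h → HEq g g' → HEq a a'
HUnion-cancelʳ {a} {g} {a'} {g'} (a#g , h≡ag) (a'#g' , h≡a'g') g≗g' l =
  merge-cancelʳ (fun g l) (a#g l) (subst (fun a' l #_) (sym (g≗g' l)) (a'#g' l))
    (trans (sym (h≡ag l)) (trans (h≡a'g' l) (cong (merge (fun a' l)) (sym (g≗g' l)))))

HUnion-respʳ-HEq : ∀ {a b c c'} → HUnion a b c → HEq c c' → HUnion a b c'
HUnion-respʳ-HEq (a#b , c≡ab) c≗c' = a#b , λ l → trans (sym (c≗c' l)) (c≡ab l)

HUnion⇒SubHeapˡ : ∀ {a b c} → HUnion a b c → SubHeap a c
HUnion⇒SubHeapˡ {b = b} (_ , c≡ab) l v a≡v = trans (c≡ab l) (cong (λ m → merge m (fun b l)) a≡v)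

HUnion⇒SubHeapʳ : ∀ {a b c} → HUnion a b c → SubHeap b c
HUnion⇒SubHeapʳ {a} (a#b , c≡ab) l v b≡v with a#b l
... | inj₁ a≡nothing = trans (c≡ab l) (cong₂ merge a≡nothing b≡v)
... | inj₂ b≡nothing = contradiction (trans (sym b≡nothing) b≡v) λ ()

SubHeap-trans : ∀ {a b c} → SubHeap a b → SubHeap b c → SubHeap a c
SubHeap-trans a⊆b b⊆c l v = b⊆c l v ∘ a⊆b l v

SubHeap-nothing : ∀ {h h'} → SubHeap h h' → ∀ l → fun h' l ≡ nothing → fun h l ≡ nothing
SubHeap-nothing {h} h⊆h' l h'≡nothing with fun h l in h≡
... | nothing = refl
... | just v  = contradiction (trans (sym h'≡nothing) (h⊆h' l v h≡)) λ ()

SubHeap-lookup : ∀ {h h' l v} → SubHeap h h' → fun h' l ≡ just v → fun h l ≢ nothing → fun h l ≡ just v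
SubHeap-lookup {h} {l = l} h⊆h' h'≡v h≢nothing with fun h l in h≡
... | nothing = contradiction refl h≢nothing
... | just w  = trans (sym (h⊆h' l w h≡)) h'≡v

Disjoint-nothingʳ : ∀ {h g} → Disjoint h g → ∀ l → fun h l ≢ nothing → fun g l ≡ nothing
Disjoint-nothingʳ h#g l h≢nothing with h#g l
... | inj₁ h≡nothing = contradiction h≡nothing h≢nothing
... | inj₂ g≡nothing = g≡nothing

-- Every heap-changing basic command acts on each cell by some f; when it leaves the cells of the
-- frame hR alone, its effect on hs ⊎ hR is its effect on hs, framed by hR.
HUnion-update : ∀ {hs hR hb hb'} (f : Loc → Maybe Val → Maybe Val) → HUnion hs hR hb →
                (∀ l → (∀ m → f l m ≡ m) ⊎ fun hR l ≡ nothing) → (∀ l → fun hb' l ≡ f l (fun hb l)) →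
                HUnion (hb' ∖ₕ hR) hR hb' × (∀ l → fun (hb' ∖ₕ hR) l ≡ f l (fun hs l))
HUnion-update {hs} {hR} {hb' = hb'} f (hs#hR , hb≡) untouched hb'≡ =
  ((proj₁ ∘ cell) , proj₁ ∘ proj₂ ∘ cell) , proj₂ ∘ proj₂ ∘ cell
  where
  cell : ∀ l → fun hb' l ∖ₘ fun hR l # fun hR l × fun hb' l ≡ merge (fun hb' l ∖ₘ fun hR l) (fun hR l) ×
               fun hb' l ∖ₘ fun hR l ≡ f l (fun hs l)
  cell l = merge-update (f l) (fun hs l) (fun hR l) (hs#hR l) (hb≡ l) (untouched l) (hb'≡ l)

Star-precise : ∀ {Γ} → All (λ r → Precise (inv r)) Γ → ∀ D s {H} h₁ h₂ → SubHeap h₁ H → SubHeap h₂ H →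
               Star Γ D s h₁ → Star Γ D s h₂ → HEq h₁ h₂
Star-precise {[]} _ D s _ _ _ _ emp₁ emp₂ l = trans (emp₁ l) (sym (emp₂ l))
Star-precise {e ∷ Γ} (prec ∷ precs) D s {H} h₁ h₂ h₁⊆H h₂⊆H star₁ star₂ with D (name e)
... | false = Star-precise precs D s {H} h₁ h₂ h₁⊆H h₂⊆H star₁ star₂
... | true with star₁ | star₂
...   | a₁ , b₁ , u₁ , inv₁ , rest₁ | a₂ , b₂ , u₂ , inv₂ , rest₂ = λ l →
  trans (proj₂ u₁ l) (trans (cong₂ merge (a₁≗a₂ l) (b₁≗b₂ l)) (sym (proj₂ u₂ l)))
  where
  a₁⊆H : SubHeap a₁ H
  a₁⊆H = SubHeap-trans {a₁} {h₁} {H} (HUnion⇒SubHeapˡ {a₁} {b₁} {h₁} u₁) h₁⊆H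
  a₂⊆H : SubHeap a₂ H
  a₂⊆H = SubHeap-trans {a₂} {h₂} {H} (HUnion⇒SubHeapˡ {a₂} {b₂} {h₂} u₂) h₂⊆H
  b₁⊆H : SubHeap b₁ H
  b₁⊆H = SubHeap-trans {b₁} {h₁} {H} (HUnion⇒SubHeapʳ {a₁} {b₁} {h₁} u₁) h₁⊆H
  b₂⊆H : SubHeap b₂ H
  b₂⊆H = SubHeap-trans {b₂} {h₂} {H} (HUnion⇒SubHeapʳ {a₂} {b₂} {h₂} u₂) h₂⊆H
  a₁≗a₂ : HEq a₁ a₂
  a₁≗a₂ = prec s H a₁ a₂ a₁⊆H a₂⊆H inv₁ inv₂
  b₁≗b₂ : HEq b₁ b₂
  b₁≗b₂ = Star-precise precs D s {H} b₁ b₂ b₁⊆H b₂⊆H rest₁ rest₂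

HUnion-Star-cancelʳ : ∀ {Γ D s a g a' g' h} → All (λ r → Precise (inv r)) Γ →
                      HUnion a g h → HUnion a' g' h → Star Γ D s g → Star Γ D s g' → HEq a a'
HUnion-Star-cancelʳ {D = D} {s} {a} {g} {a'} {g'} {h} precs u u' star star' =
  HUnion-cancelʳ {a} {g} {a'} {g'} {h} u u'
    (Star-precise precs D s {h} g g' (HUnion⇒SubHeapʳ {a} {g} {h} u) (HUnion⇒SubHeapʳ {a'} {g'} {h} u')
                  star star')

infix 4 _≈[_]_
_≈[_]_ : Store → VarSet → Store → Set
s ≈[ X ] s' = ∀ x → X x → s x ≡ s' x

≈-sym : ∀ {s X s'} → s ≈[ X ] s' → s' ≈[ X ] s
≈-sym s≈s' x = sym ∘ s≈s' x

≈-∪ˡ : ∀ {s X Y s'} → s ≈[ X ∪ᵥ Y ] s' → s ≈[ X ] s'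
≈-∪ˡ s≈s' x = s≈s' x ∘ inj₁

≈-∪ʳ : ∀ {s X Y s'} → s ≈[ X ∪ᵥ Y ] s' → s ≈[ Y ] s'
≈-∪ʳ s≈s' x = s≈s' x ∘ inj₂

update-same : ∀ (s : Store) x v → (s [ x ↦ v ]) x ≡ v
update-same s x v = cong (λ b → if b then v else s x) (dec-true (x ℕ.≟ x) refl)

update-other : ∀ (s : Store) x v {y} → y ≢ x → (s [ x ↦ v ]) y ≡ s y
update-other s x v {y} y≢x = cong (λ b → if b then v else s y) (dec-false (y ℕ.≟ x) y≢x)

≈-update : ∀ {s s' x X} v → s ≈[ (λ y → y ≢ x × X y) ] s' → (s [ x ↦ v ]) ≈[ X ] (s' [ x ↦ v ])
≈-update {s} {s'} {x} v s≈s' y y∈X with y ℕ.≟ x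
... | yes refl = trans (update-same s x v) (sym (update-same s' x v))
... | no  y≢x  =
  trans (update-other s x v y≢x) (trans (s≈s' y (y≢x , y∈X)) (sym (update-other s' x v y≢x)))

eval-coincidence : ∀ e {s s'} → s ≈[ FVₑ e ] s' → ⟦ e ⟧ s ≡ ⟦ e ⟧ s'
eval-coincidence (num _) _ = refl
eval-coincidence (var x) s≈s' = s≈s' x refl
eval-coincidence (e ⊕ e') s≈s' =
  cong₂ ℤ._+_ (eval-coincidence e (≈-∪ˡ s≈s')) (eval-coincidence e' (≈-∪ʳ s≈s'))
eval-coincidence (e ⊖ e') s≈s' =
  cong₂ ℤ._-_ (eval-coincidence e (≈-∪ˡ s≈s')) (eval-coincidence e' (≈-∪ʳ s≈s'))
eval-coincidence (e ⊗ e') s≈s' =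
  cong₂ ℤ._*_ (eval-coincidence e (≈-∪ˡ s≈s')) (eval-coincidence e' (≈-∪ʳ s≈s'))

beval-coincidence : ∀ b {s s'} → s ≈[ FVᵇ b ] s' → ⟦ b ⟧ᵇ s ≡ ⟦ b ⟧ᵇ s'
beval-coincidence btrue _ = refl
beval-coincidence bfalse _ = refl
beval-coincidence (e ≐ e') s≈s' =
  cong₂ (λ m n → does (m ℤ.≟ n)) (eval-coincidence e (≈-∪ˡ s≈s')) (eval-coincidence e' (≈-∪ʳ s≈s'))
beval-coincidence (e ≤ₑ e') s≈s' =
  cong₂ (λ m n → does (m ℤ.≤? n)) (eval-coincidence e (≈-∪ˡ s≈s')) (eval-coincidence e' (≈-∪ʳ s≈s'))
beval-coincidence (bnot b) s≈s' = cong not (beval-coincidence b s≈s')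
beval-coincidence (b band b') s≈s' =
  cong₂ _∧_ (beval-coincidence b (≈-∪ˡ s≈s')) (beval-coincidence b' (≈-∪ʳ s≈s'))
beval-coincidence (b bor b') s≈s' =
  cong₂ _∨_ (beval-coincidence b (≈-∪ˡ s≈s')) (beval-coincidence b' (≈-∪ʳ s≈s'))

sat-coincidence : ∀ P {s s' h} → s ≈[ FV P ] s' → sat s h P → sat s' h P
sat-coincidence (pure b) s≈s' = subst T (beval-coincidence b s≈s')
sat-coincidence emp _ empty = empty
sat-coincidence (e ↦ e') s≈s' pt l = trans (pt l)
  (cong₂ (λ a v → if does (l ℤ.≟ a) then just v else nothing)
         (eval-coincidence e (≈-∪ˡ s≈s')) (eval-coincidence e' (≈-∪ʳ s≈s')))
sat-coincidence (P ∗ Q) s≈s' (h₁ , h₂ , u , p , q) =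
  h₁ , h₂ , u , sat-coincidence P (≈-∪ˡ s≈s') p , sat-coincidence Q (≈-∪ʳ s≈s') q
sat-coincidence (P -∗ Q) s≈s' wand h₁ h₂ u p =
  sat-coincidence Q (≈-∪ʳ s≈s') (wand h₁ h₂ u (sat-coincidence P (≈-sym (≈-∪ˡ s≈s')) p))
sat-coincidence (P ∧ₐ Q) s≈s' (p , q) =
  sat-coincidence P (≈-∪ˡ s≈s') p , sat-coincidence Q (≈-∪ʳ s≈s') q
sat-coincidence (P ∨ₐ Q) s≈s' =
  ⊎.map (sat-coincidence P (≈-∪ˡ s≈s')) (sat-coincidence Q (≈-∪ʳ s≈s'))
sat-coincidence (¬ₐ P) s≈s' ¬p = ¬p ∘ sat-coincidence P (≈-sym s≈s')
sat-coincidence (∀ₐ x P) s≈s' p v = sat-coincidence P (≈-update v s≈s') (p v)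
sat-coincidence (∃ₐ x P) s≈s' (v , p) = v , sat-coincidence P (≈-update v s≈s') p

Step-Mod-⊆ : ∀ {C s h ρ C' s' h' ρ'} → Step C s h ρ C' s' h' ρ' → ∀ x → Mod C' x → Mod C x
Step-Mod-⊆ S1 x = inj₂
Step-Mod-⊆ (S2 st) x = ⊎.map₁ (Step-Mod-⊆ st x)
Step-Mod-⊆ LP x (inj₁ (inj₁ m)) = m
Step-Mod-⊆ LP x (inj₁ (inj₂ m)) = m
Step-Mod-⊆ (IF1 _) x = inj₁
Step-Mod-⊆ (IF2 _) x = inj₂
Step-Mod-⊆ (P1 st) x = ⊎.map₁ (Step-Mod-⊆ st x)
Step-Mod-⊆ (P2 st) x = ⊎.map₂ (Step-Mod-⊆ st x)
Step-Mod-⊆ (R1 _ _ st) x = Step-Mod-⊆ st x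
Step-Mod-⊆ (R2 _ _ st) x = Step-Mod-⊆ st x
Step-Mod-⊆ (W0 _ _) x m = m
Step-Mod-⊆ (W1 _ st) x = Step-Mod-⊆ st x

BStep-unmodified : ∀ {c s h s' h'} → BStep c s h s' h' → ∀ x → ¬ ModB c x → s' x ≡ s x
BStep-unmodified (assign-step {x = y} {e} {s}) x = update-other s y (⟦ e ⟧ s)
BStep-unmodified (load-step {x = y} {s = s} {v = v} _) x = update-other s y v
BStep-unmodified (store-step _ _) x _ = refl
BStep-unmodified (cons-step {x = y} {s = s} l _ _) x = update-other s y l
BStep-unmodified (dispose-step _ _) x _ = refl

Step-unmodified : ∀ {C s h ρ C' s' h' ρ'} → Step C s h ρ C' s' h' ρ' → ∀ x → ¬ Mod C x → s' x ≡ s x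
Step-unmodified S1 x _ = refl
Step-unmodified (S2 st) x x∉ = Step-unmodified st x (x∉ ∘ inj₁)
Step-unmodified LP x _ = refl
Step-unmodified (IF1 _) x _ = refl
Step-unmodified (IF2 _) x _ = refl
Step-unmodified (P1 st) x x∉ = Step-unmodified st x (x∉ ∘ inj₁)
Step-unmodified (P2 st) x x∉ = Step-unmodified st x (x∉ ∘ inj₂)
Step-unmodified P3 x _ = refl
Step-unmodified (R0 _) x _ = refl
Step-unmodified (R1 _ _ st) x = Step-unmodified st x
Step-unmodified (R2 _ _ st) x = Step-unmodified st x
Step-unmodified (W0 _ _) x _ = refl
Step-unmodified (W1 _ st) x = Step-unmodified st x
Step-unmodified (W2 _) x _ = refl
Step-unmodified (BCT bst) x = BStep-unmodified bst x

-- Unlike Abort, Faults does not depend on the resource configuration, which the rules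
-- R1, R2 and W1 change differently from RA1, RA2 and WA1.
data Faults (s : Store) (h : Heap) : Cmd → Set where
  in-basic    : ∀ {c} → BAbort c s h → Faults s h (basic c)
  in-seq      : ∀ {C₁ C₂} → Faults s h C₁ → Faults s h (C₁ ⨾ C₂)
  in-par₁     : ∀ {C₁ C₂} → Faults s h C₁ → Faults s h (C₁ ∥ C₂)
  in-par₂     : ∀ {C₁ C₂} → Faults s h C₂ → Faults s h (C₁ ∥ C₂)
  in-resource : ∀ {r C} → Faults s h C → Faults s h (resource r C)
  in-within   : ∀ {r C} → Faults s h C → Faults s h (within r C)

Locked? : ∀ C r → Dec (Locked C r)
Locked? skip r = no λ ()
Locked? (basic c) r = no λ ()
Locked? (C₁ ⨾ C₂) r = Locked? C₁ r
Locked? (ifte B C₁ C₂) r = no λ ()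
Locked? (while B C) r = no λ ()
Locked? (resource r' C) r = Locked? C r ×-dec ¬? (r ℕ.≟ r')
Locked? (withr r' B C) r = no λ ()
Locked? (C₁ ∥ C₂) r = Locked? C₁ r ⊎-dec Locked? C₂ r
Locked? (within r' C) r = Locked? C r ⊎-dec (r ℕ.≟ r')

Faults⇒Abort : ∀ {C s h} → Faults s h C → ∀ ρ → Abort C s h ρ
Faults⇒Abort (in-basic ab) ρ = BCA ab
Faults⇒Abort (in-seq f) ρ = SA (Faults⇒Abort f ρ)
Faults⇒Abort (in-par₁ f) ρ = PA1 (Faults⇒Abort f ρ)
Faults⇒Abort (in-par₂ f) ρ = PA2 (Faults⇒Abort f ρ)
Faults⇒Abort (in-within {r} f) ρ = WA1 (Faults⇒Abort f (ρ ∖ρ r))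
Faults⇒Abort (in-resource {r} {C} f) ρ with T? (O ρ r ∨ L ρ r ∨ D ρ r) | Locked? C r
... | yes r∈ρ | _          = RA r∈ρ
... | no  r∉ρ | yes locked = RA1 r∉ρ locked (Faults⇒Abort f _)
... | no  r∉ρ | no  free   = RA2 r∉ρ free (Faults⇒Abort f _)

BAbort-antimono : ∀ {c s h h'} → SubHeap h h' → BAbort c s h' → BAbort c s h
BAbort-antimono {h = h} {h'} h⊆h' (load-abort {e = e} {s} miss) =
  load-abort (SubHeap-nothing {h} {h'} h⊆h' (⟦ e ⟧ s) miss)
BAbort-antimono {h = h} {h'} h⊆h' (store-abort {e = e} {s = s} miss) =
  store-abort (SubHeap-nothing {h} {h'} h⊆h' (⟦ e ⟧ s) miss)
BAbort-antimono {h = h} {h'} h⊆h' (dispose-abort {e} {s} miss) =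
  dispose-abort (SubHeap-nothing {h} {h'} h⊆h' (⟦ e ⟧ s) miss)

Abort-antimono : ∀ {C s h h' ρ} → SubHeap h h' → Abort C s h' ρ → Abort C s h ρ
Abort-antimono h⊆h' (RA r∈ρ) = RA r∈ρ
Abort-antimono h⊆h' (WA r∉ρ) = WA r∉ρ
Abort-antimono h⊆h' (RA1 r∉ρ locked ab) = RA1 r∉ρ locked (Abort-antimono h⊆h' ab)
Abort-antimono h⊆h' (RA2 r∉ρ free ab) = RA2 r∉ρ free (Abort-antimono h⊆h' ab)
Abort-antimono h⊆h' (BCA ab) = BCA (BAbort-antimono h⊆h' ab)
Abort-antimono h⊆h' (SA ab) = SA (Abort-antimono h⊆h' ab)
Abort-antimono h⊆h' (WA1 ab) = WA1 (Abort-antimono h⊆h' ab)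
Abort-antimono h⊆h' (WA2 r∉O) = WA2 r∉O
Abort-antimono h⊆h' (PA1 ab) = PA1 (Abort-antimono h⊆h' ab)
Abort-antimono h⊆h' (PA2 ab) = PA2 (Abort-antimono h⊆h' ab)

Faults-antimono : ∀ {C s h h'} → SubHeap h h' → Faults s h' C → Faults s h C
Faults-antimono h⊆h' (in-basic ab) = in-basic (BAbort-antimono h⊆h' ab)
Faults-antimono h⊆h' (in-seq f) = in-seq (Faults-antimono h⊆h' f)
Faults-antimono h⊆h' (in-par₁ f) = in-par₁ (Faults-antimono h⊆h' f)
Faults-antimono h⊆h' (in-par₂ f) = in-par₂ (Faults-antimono h⊆h' f)
Faults-antimono h⊆h' (in-resource f) = in-resource (Faults-antimono h⊆h' f)
Faults-antimono h⊆h' (in-within f) = in-within (Faults-antimono h⊆h' f)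

overwrite : Loc → Maybe Val → Loc → Maybe Val → Maybe Val
overwrite a new l m = if does (l ℤ.≟ a) then new else m

overwrite-framed : ∀ {hs hR hb a} new → HUnion hs hR hb → fun hs a ≢ nothing →
                   ∀ l → (∀ m → overwrite a new l m ≡ m) ⊎ fun hR l ≡ nothing
overwrite-framed {hs} {hR} {a = a} _ (hs#hR , _) a∈hs l with l ℤ.≟ a
... | yes refl = inj₂ (Disjoint-nothingʳ {hs} {hR} hs#hR l a∈hs)
... | no  _    = inj₁ λ _ → refl

alloc-framed : ∀ {hs hR hb} (block : Loc → Maybe Val) → HUnion hs hR hb →
               (∀ l → block l ≢ nothing → fun hb l ≡ nothing) →
               ∀ l → (∀ m → merge (block l) m ≡ m) ⊎ fun hR l ≡ nothing
alloc-framed {hs} {hR} {hb} block u fresh l with block l in block≡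
... | nothing = inj₁ λ _ → refl
... | just _  = inj₂ (SubHeap-nothing {hR} {hb} (HUnion⇒SubHeapʳ {hs} {hR} {hb} u) l
                        (fresh l λ none → contradiction (trans (sym block≡) none) λ ()))

BStep-local : ∀ {c s hb s' hb' hs} hR → BStep c s hb s' hb' → ¬ BAbort c s hs → HUnion hs hR hb →
              Σ Heap λ hs' → BStep c s hs s' hs' × HUnion hs' hR hb'
BStep-local _ assign-step _ u = _ , assign-step , u
BStep-local {hb = hb} {hs = hs} hR (load-step hb∋v) no-fault u =
  hs , load-step (SubHeap-lookup {hs} {hb} (HUnion⇒SubHeapˡ {hs} {hR} {hb} u) hb∋v (no-fault ∘ load-abort)) ,
  u
BStep-local {hb = hb} {hb' = hb'} {hs} hR (store-step {e = e} {e'} {s} hb∋v hb'≡) no-fault u =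
  let a∈hs = no-fault ∘ store-abort
      (u' , hs'≡) = HUnion-update {hs} {hR} {hb} {hb'} (overwrite (⟦ e ⟧ s) (just (⟦ e' ⟧ s))) u
                      (overwrite-framed {hs} {hR} {hb} _ u a∈hs) hb'≡
  in hb' ∖ₕ hR ,
     store-step (SubHeap-lookup {hs} {hb} (HUnion⇒SubHeapˡ {hs} {hR} {hb} u) hb∋v a∈hs) hs'≡ , u'
BStep-local {hb = hb} {hb' = hb'} {hs} hR (dispose-step {e = e} {s} hb∋v hb'≡) no-fault u =
  let a∈hs = no-fault ∘ dispose-abort
      (u' , hs'≡) = HUnion-update {hs} {hR} {hb} {hb'} (overwrite (⟦ e ⟧ s) nothing) u
                      (overwrite-framed {hs} {hR} {hb} _ u a∈hs) hb'≡
  in hb' ∖ₕ hR ,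
     dispose-step (SubHeap-lookup {hs} {hb} (HUnion⇒SubHeapˡ {hs} {hR} {hb} u) hb∋v a∈hs) hs'≡ , u'
BStep-local {hb = hb} {hb' = hb'} {hs} hR (cons-step {es = es} {s} l fresh hb'≡) _ u =
  let block = allocAt l (map (λ e → ⟦ e ⟧ s) es)
      (u' , hs'≡) = HUnion-update {hs} {hR} {hb} {hb'} (merge ∘ block) u
                      (alloc-framed {hs} {hR} {hb} block u fresh) hb'≡
      fresh' = λ l' → SubHeap-nothing {hs} {hb} (HUnion⇒SubHeapˡ {hs} {hR} {hb} u) l' ∘ fresh l'
  in hb' ∖ₕ hR , cons-step l fresh' hs'≡ , u'

Step-local : ∀ {C s hb ρ C' s' hb' ρ' hs} hR → Step C s hb ρ C' s' hb' ρ' → ¬ Faults s hs C →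
             HUnion hs hR hb → Σ Heap λ hs' → Step C s hs ρ C' s' hs' ρ' × HUnion hs' hR hb'
Step-local _ S1 _ u = _ , S1 , u
Step-local hR (S2 st) no-fault u = Σ.map₂ (Σ.map₁ S2) (Step-local hR st (no-fault ∘ in-seq) u)
Step-local _ LP _ u = _ , LP , u
Step-local _ (IF1 B≡true) _ u = _ , IF1 B≡true , u
Step-local _ (IF2 B≡false) _ u = _ , IF2 B≡false , u
Step-local hR (P1 st) no-fault u = Σ.map₂ (Σ.map₁ P1) (Step-local hR st (no-fault ∘ in-par₁) u)
Step-local hR (P2 st) no-fault u = Σ.map₂ (Σ.map₁ P2) (Step-local hR st (no-fault ∘ in-par₂) u)
Step-local _ P3 _ u = _ , P3 , u
Step-local _ (R0 r∉ρ) _ u = _ , R0 r∉ρ , u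
Step-local hR (R1 r∉ρ locked st) no-fault u =
  Σ.map₂ (Σ.map₁ (R1 r∉ρ locked)) (Step-local hR st (no-fault ∘ in-resource) u)
Step-local hR (R2 r∉ρ free st) no-fault u =
  Σ.map₂ (Σ.map₁ (R2 r∉ρ free)) (Step-local hR st (no-fault ∘ in-resource) u)
Step-local _ (W0 r∈D B≡true) _ u = _ , W0 r∈D B≡true , u
Step-local hR (W1 r∈O st) no-fault u =
  Σ.map₂ (Σ.map₁ (W1 r∈O)) (Step-local hR st (no-fault ∘ in-within) u)
Step-local _ (W2 r∈O) _ u = _ , W2 r∈O , u
Step-local hR (BCT bst) no-fault u =
  Σ.map₂ (Σ.map₁ BCT) (BStep-local hR bst (no-fault ∘ in-basic) u)

frame : ∀ n {C Γ h hR s ρ Q R A} → All (λ r → Precise (inv r)) Γ → sat s hR R →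
        Safe n C s h ρ Γ Q A → (∀ x → Mod C x → ¬ FV R x) →
        ∀ hhR → HUnion h hR hhR → Safe n C s hhR ρ Γ (Q ∗ R) (A ∪ᵥ FV R)
frame zero _ _ _ _ _ _ = tt
frame (suc n) {C} {Γ} {h} {hR} {s} {ρ} {Q} {R} {A} precs sat-R (post , no-abort , chng , steps) R-fixed
      hhR u =
  (λ C≡skip → h , hR , u , post C≡skip , sat-R) ,
  no-abort ∘ Abort-antimono {C} {s} {h} {hhR} (HUnion⇒SubHeapˡ {h} {hR} {hhR} u) ,
  chng ,
  framed-steps
  where
  reframe : ∀ {C' s' ρ' hs' hb' h' hG'} → HUnion h' hG' hs' → HUnion hs' hR hb' →
            Star Γ (D ρ') s' hG' → Safe n C' s' h' ρ' Γ Q A →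
            s ≈[ FV R ] s' → (∀ x → Mod C' x → ¬ FV R x) →
            Σ Heap λ h'' → Σ Heap λ hG'' →
              HUnion h'' hG'' hb' × Star Γ (D ρ') s' hG'' × Safe n C' s' h'' ρ' Γ (Q ∗ R) (A ∪ᵥ FV R)
  reframe {hs' = hs'} {hb'} {h'} {hG'} u₁ u₂ star safe' s≈s' R-fixed' =
    let (u₃ , u₄) = HUnion-regroup {h'} {hG'} {hs'} {hR} {hb'} u₁ u₂
    in h' ∪ₕ hR , hG' , u₄ , star ,
       frame n precs (sat-coincidence R s≈s' sat-R) safe' R-fixed' (h' ∪ₕ hR) u₃

  framed-steps : ∀ hG hb → HUnion hhR hG hb → Star Γ (D ρ) s hG →
                 ∀ C' s' hb' ρ' → Trans (A ∪ᵥ FV R) Γ C s hb ρ C' s' hb' ρ' →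
                 Σ Heap λ h' → Σ Heap λ hG' →
                   HUnion h' hG' hb' × Star Γ (D ρ') s' hG' × Safe n C' s' h' ρ' Γ (Q ∗ R) (A ∪ᵥ FV R)
  framed-steps hG hb u' starG C' s' hb' ρ' (prog st) =
    let (u₁ , u₂) = HUnion-regroup {h} {hR} {hhR} {hG} {hb} u u'
        no-fault = λ f → no-abort (Faults⇒Abort (Faults-antimono {C} {s} {h} {h ∪ₕ hG}
                                 (HUnion⇒SubHeapˡ {h} {hG} {h ∪ₕ hG} u₁) f) ρ)
        (hs' , st' , u₃) = Step-local hR st no-fault u₂
        (h' , hG' , u₄ , starG' , safe') = steps hG (h ∪ₕ hG) u₁ starG C' s' hs' ρ' (prog st')
    in reframe {hs' = hs'} {hb'} {h'} {hG'} u₄ u₃ starG' safe'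
         (λ x fv → sym (Step-unmodified st x λ m → R-fixed x m fv)) (λ x → R-fixed x ∘ Step-Mod-⊆ st x)
  framed-steps hG hb u' starG .C s' hb' _
               (envt (env hc hE hE' .hb .hb' uE uE' agree L'D'≡LD ρ'-config starE starE')) =
    let hc≗hhR = HUnion-Star-cancelʳ {Γ} {D ρ} {s} {hc} {hE} {hhR} {hG} {hb} precs uE u' starE starG
        (u₁ , _) = HUnion-regroup {h} {hR} {hhR} {hG} {hb} u u'
        (u₂ , u₃) = HUnion-regroup {h} {hR} {hc} {hE'} {hb'}
                      (HUnion-respʳ-HEq {h} {hR} {hhR} {hc} u (sym ∘ hc≗hhR)) uE'
        env-step = env h hG hE' (h ∪ₕ hG) (h ∪ₕ hE') u₁ u₂ (λ x → agree x ∘ ⊎.map₁ inj₁)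
                       L'D'≡LD ρ'-config starG starE'
        (h' , hG' , u₄ , starG' , safe') = steps hG (h ∪ₕ hG) u₁ starG C s' (h ∪ₕ hE') _ (envt env-step)
    in reframe {hs' = h ∪ₕ hE'} {hb'} {h'} {hG'} u₄ u₃ starG' safe'
         (λ x → agree x ∘ inj₁ ∘ inj₂) R-fixed

proposition12 : (n : ℕ) (C : Cmd) (Γ : Ctx) (h hR : Heap) (s : Store) (ρ : Config)
                (Q R : Assn) (A : VarSet) →
                Reachable C → ResCtx Γ → IsConfig ρ →
                Disjoint h hR → sat s hR R →
                Safe n C s h ρ Γ Q A →
                (∀ x → Mod C x → ¬ FV R x) →
                ∀ hhR → HUnion h hR hhR →
                Safe n C s hhR ρ Γ (Q ∗ R) (A ∪ᵥ FV R)
proposition12 n C Γ h hR s ρ Q R A _ (_ , wf) _ _ sat-R safe R-fixed =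
  frame n (All.map proj₁ wf) sat-R safe R-fixed
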